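{- For every integer $n>2$ there exists a double-MDS-code $M\subseteq\{0,1,2,3\}^n$ that is not splittable, but such that every layer of $M$ (in every direction $i\in\{1,\dots,n\}$ and for every value $a\in\{0,1,2,3\}$) is a splittable double-MDS-code in $\{0,1,2,3\}^{n-1}$.
   Context: Let $\Sigma=\{0,1,2,3\}$. The Hamming graph $H(n,4)$ has vertex set $\Sigma^n$, two words adjacent iff they differ in exactly one coordinate. A line is a set of $4$ words agreeing in all coordinates but one. A set $S\subseteq\Sigma^n$ is a double-MDS-code if every line contains exactly two elements of $S$. A set $S$ with every line containing $0$ or $2$ of its elements is called a double-code; it is splittable if $S$ is the union of two sets each of which is independent in $H(n,4)$ (equivalently, the subgraph of $H(n,4)$ induced by $S$ is bipartite). For $i\in\{1,\dots,n\}$ and $a\in\Sigma$, the layer of $S$ of direction $i$ and value $a$ is $\{x\in S: x_i=a\}$, identified with a subset of $\Sigma^{n-1}$ by deleting the $i$th coordinate. -}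

module Defs where

open import Data.Nat using (ℕ; zero; suc)
open import Data.Fin using (Fin)
open import Data.Bool using (Bool; true; false; _∨_)
open import Data.Vec using (Vec; lookup; _[_]≔_; insertAt; countᵇ; allFin)
open import Data.Product using (Σ; ∃; _×_)
open import Data.Empty using (⊥)
open import Relation.Binary.PropositionalEquality using (_≡_; _≢_)

Alphabet : Set
Alphabet = Fin 4

Word : ℕ → Set
Word n = Vec Alphabet n

Code : ℕ → Set
Code n = Word n → Bool

Adjacent : {n : ℕ} → Word n → Word n → Set
Adjacent {n} x y = Σ (Fin n) λ i → (lookup x i ≢ lookup y i) × (y ≡ x [ i ]≔ lookup y i)

lineCount : {n : ℕ} → Code n → Fin n → Word n → ℕ
lineCount S i x = countᵇ (λ a → S (x [ i ]≔ a)) (allFin 4)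

IsDoubleMDS : {n : ℕ} → Code n → Set
IsDoubleMDS {n} S = (i : Fin n) (x : Word n) → lineCount S i x ≡ 2

Independent : {n : ℕ} → Code n → Set
Independent {n} A = (x y : Word n) → A x ≡ true → A y ≡ true → Adjacent x y → ⊥

Splittable : {n : ℕ} → Code n → Set
Splittable {n} S = Σ (Code n) λ A → Σ (Code n) λ B →
  ((x : Word n) → S x ≡ A x ∨ B x) × Independent A × Independent B

layer : {m : ℕ} → Code (suc m) → Fin (suc m) → Alphabet → Code m
layer S i a y = S (insertAt y i a)

-- Identify Σ with 𝔽₂², so that its three nonzero characters hi, lo and hi+lo each split Σ
-- into two pairs. The code M consists of the words c y with χ(c) = Σⱼ hi(yⱼ), where the
-- character χ applied to the first letter is hi if the tail y lies in {0,3}ⁿ = ker(hi+lo),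
-- lo if it lies in {1,2}ⁿ, and hi+lo otherwise. The character χ depends on a tail letter e
-- only through (hi+lo)(e), so every line of M through a tail coordinate is the graph of a
-- map 𝔽₂ → 𝔽₂ in the coordinates (hi+lo, hi): it has two points, with different hi+lo.
-- Hence the parity of hi+lo over the tail properly colours every layer with fixed first
-- letter; a layer with a fixed tail letter a excludes one character from the role of χ,
-- and that character, added to the colour, also separates the points on the first-coordinate
-- lines. Without any fixed letter, M contains an odd cycle, of length 2n + 1.
module Submission where

open import Defs
open import Data.Nat using (ℕ; zero; suc; _≤_; s≤s; z≤n)
open import Data.Fin using (Fin; zero; suc; punchIn)
open import Data.Fin.Patterns using (0F; 1F; 2F; 3F)
open import Data.Bool using (Bool; true; false; not; _∧_; _∨_; _xor_)
open import Data.Bool.Properties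
  using (not-injective; not-¬; ¬-not; not-distribˡ-xor; not-distribʳ-xor;
         ∧-conicalˡ; ∧-conicalʳ; ∧-identityʳ; ∧-distribˡ-∨; ∨-inverseʳ;
         ∧-commutativeMonoid; xor-∧-commutativeRing)
open import Data.Vec
  using (Vec; []; _∷_; lookup; _[_]≔_; insertAt; removeAt; replicate; foldr′; countᵇ; allFin)
open import Data.Vec.Properties using (insertAt-lookup; insertAt-punchIn; insertAt-removeAt)
open import Data.Vec.Relation.Unary.All using (All; []; _∷_)
open import Data.Product using (Σ; ∃; _×_; _,_)
open import Function using (_∘_; _∘′_; const; _$_)
open import Relation.Nullary using (¬_; contradiction)
open import Relation.Binary.PropositionalEquality
  using (_≡_; _≢_; _≗_; refl; sym; trans; cong; subst; subst₂; module ≡-Reasoning)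
open import Algebra.Bundles using (CommutativeRing; CommutativeMonoid)
open import Algebra.Properties.Group (CommutativeRing.+-group xor-∧-commutativeRing)
  using (∙-cancelˡ; ∙-cancelʳ)
open import Algebra.Properties.CommutativeSemigroup
  (CommutativeMonoid.commutativeSemigroup (CommutativeRing.+-commutativeMonoid xor-∧-commutativeRing))
  using () renaming (x∙yz≈y∙xz to xor-leftComm)
open import Algebra.Properties.CommutativeSemigroup
  (CommutativeMonoid.commutativeSemigroup ∧-commutativeMonoid)
  using () renaming (x∙yz≈y∙xz to ∧-leftComm)

private
  variable
    A B : Set
    n : ℕ

xor-≢ˡ : ∀ x {y z} → y ≢ z → x xor y ≢ x xor z
xor-≢ˡ x {y} {z} y≢z = y≢z ∘ ∙-cancelˡ x y z

xor-≢ʳ : ∀ {x y} z → x ≢ y → x xor z ≢ y xor z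
xor-≢ʳ {x} {y} z x≢y = x≢y ∘ ∙-cancelʳ z x y

_==_ : Bool → Bool → Bool
x == y = not (x xor y)

==⇒≡ : ∀ {x y} → x == y ≡ true → x ≡ y
==⇒≡ {false} {false} _ = refl
==⇒≡ {true}  {true}  _ = refl

countᵇ-cong : {p q : A → Bool} → p ≗ q → (xs : Vec A n) → countᵇ p xs ≡ countᵇ q xs
countᵇ-cong p≗q []       = refl
countᵇ-cong p≗q (x ∷ xs) rewrite p≗q x | countᵇ-cong p≗q xs = refl

All-replicate : {P : A → Set} {a : A} → P a → All P (replicate n a)
All-replicate {n = zero}  Pa = []
All-replicate {n = suc n} Pa = Pa ∷ All-replicate Pa

foldr′-insertAt : (_∙_ : A → B → B) → (∀ x y b → x ∙ (y ∙ b) ≡ y ∙ (x ∙ b)) →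
                  ∀ ε (xs : Vec A n) i x → foldr′ _∙_ ε (insertAt xs i x) ≡ x ∙ foldr′ _∙_ ε xs
foldr′-insertAt _∙_ leftComm ε xs       zero    x = refl
foldr′-insertAt _∙_ leftComm ε (y ∷ xs) (suc i) x =
  trans (cong (y ∙_) (foldr′-insertAt _∙_ leftComm ε xs i x)) (leftComm y x _)

insertAt-[]≔ : ∀ (xs : Vec A n) i v w → insertAt xs i v [ i ]≔ w ≡ insertAt xs i w
insertAt-[]≔ xs       zero    v w = refl
insertAt-[]≔ (x ∷ xs) (suc i) v w = cong (x ∷_) (insertAt-[]≔ xs i v w)

[]≔-as-insertAt : ∀ (xs : Vec A (suc n)) i w → xs [ i ]≔ w ≡ insertAt (removeAt xs i) i w
[]≔-as-insertAt xs i w =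
  trans (cong (_[ i ]≔ w) (sym (insertAt-removeAt xs i))) (insertAt-[]≔ (removeAt xs i) i _ w)

insertAt-[]≔-punchIn : ∀ (xs : Vec A n) i j v w →
                       insertAt (xs [ j ]≔ w) i v ≡ insertAt xs i v [ punchIn i j ]≔ w
insertAt-[]≔-punchIn xs       zero    j       v w = refl
insertAt-[]≔-punchIn (x ∷ xs) (suc i) zero    v w = refl
insertAt-[]≔-punchIn (x ∷ xs) (suc i) (suc j) v w = cong (x ∷_) (insertAt-[]≔-punchIn xs i j v w)

data Character : Set where
  hi lo hi+lo : Character

-- a ↦ (⟦ hi ⟧ a , ⟦ lo ⟧ a) is the binary expansion of a.
⟦_⟧ : Character → Alphabet → Bool
⟦ hi ⟧ 0F = false
⟦ hi ⟧ 1F = false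
⟦ hi ⟧ 2F = true
⟦ hi ⟧ 3F = true
⟦ lo ⟧ 0F = false
⟦ lo ⟧ 1F = true
⟦ lo ⟧ 2F = false
⟦ lo ⟧ 3F = true
⟦ hi+lo ⟧ 0F = false
⟦ hi+lo ⟧ 1F = true
⟦ hi+lo ⟧ 2F = true
⟦ hi+lo ⟧ 3F = false

⟦hi+lo⟧≡hi-xor-lo : ∀ a → ⟦ hi+lo ⟧ a ≡ ⟦ hi ⟧ a xor ⟦ lo ⟧ a
⟦hi+lo⟧≡hi-xor-lo 0F = refl
⟦hi+lo⟧≡hi-xor-lo 1F = refl
⟦hi+lo⟧≡hi-xor-lo 2F = refl
⟦hi+lo⟧≡hi-xor-lo 3F = refl

⟦⟧-0F : ∀ κ → ⟦ κ ⟧ 0F ≡ false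
⟦⟧-0F hi    = refl
⟦⟧-0F lo    = refl
⟦⟧-0F hi+lo = refl

bits-injective : ∀ {a b} → ⟦ hi ⟧ a ≡ ⟦ hi ⟧ b → ⟦ lo ⟧ a ≡ ⟦ lo ⟧ b → a ≡ b
bits-injective {a} {b} hi≡ lo≡ = begin
  a                              ≡⟨ fromBits-bits a ⟨
  fromBits (⟦ hi ⟧ a) (⟦ lo ⟧ a) ≡⟨ cong (fromBits (⟦ hi ⟧ a)) lo≡ ⟩
  fromBits (⟦ hi ⟧ a) (⟦ lo ⟧ b) ≡⟨ cong (λ h → fromBits h (⟦ lo ⟧ b)) hi≡ ⟩
  fromBits (⟦ hi ⟧ b) (⟦ lo ⟧ b) ≡⟨ fromBits-bits b ⟩
  b                              ∎
  where
  open ≡-Reasoning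
  fromBits : Bool → Bool → Alphabet
  fromBits false false = 0F
  fromBits false true  = 1F
  fromBits true  false = 2F
  fromBits true  true  = 3F
  fromBits-bits : ∀ a → fromBits (⟦ hi ⟧ a) (⟦ lo ⟧ a) ≡ a
  fromBits-bits 0F = refl
  fromBits-bits 1F = refl
  fromBits-bits 2F = refl
  fromBits-bits 3F = refl

hi-fromOthers : ∀ {a b} → ⟦ lo ⟧ a ≡ ⟦ lo ⟧ b → ⟦ hi+lo ⟧ a ≡ ⟦ hi+lo ⟧ b → ⟦ hi ⟧ a ≡ ⟦ hi ⟧ b
hi-fromOthers {a} {b} lo≡ sum≡ = ∙-cancelʳ (⟦ lo ⟧ a) (⟦ hi ⟧ a) (⟦ hi ⟧ b) $ begin
  ⟦ hi ⟧ a xor ⟦ lo ⟧ a ≡⟨ ⟦hi+lo⟧≡hi-xor-lo a ⟨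
  ⟦ hi+lo ⟧ a           ≡⟨ sum≡ ⟩
  ⟦ hi+lo ⟧ b           ≡⟨ ⟦hi+lo⟧≡hi-xor-lo b ⟩
  ⟦ hi ⟧ b xor ⟦ lo ⟧ b ≡⟨ cong (⟦ hi ⟧ b xor_) lo≡ ⟨
  ⟦ hi ⟧ b xor ⟦ lo ⟧ a ∎
  where open ≡-Reasoning

lo-fromOthers : ∀ {a b} → ⟦ hi ⟧ a ≡ ⟦ hi ⟧ b → ⟦ hi+lo ⟧ a ≡ ⟦ hi+lo ⟧ b → ⟦ lo ⟧ a ≡ ⟦ lo ⟧ b
lo-fromOthers {a} {b} hi≡ sum≡ = ∙-cancelˡ (⟦ hi ⟧ a) (⟦ lo ⟧ a) (⟦ lo ⟧ b) $ begin
  ⟦ hi ⟧ a xor ⟦ lo ⟧ a ≡⟨ ⟦hi+lo⟧≡hi-xor-lo a ⟨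
  ⟦ hi+lo ⟧ a           ≡⟨ sum≡ ⟩
  ⟦ hi+lo ⟧ b           ≡⟨ ⟦hi+lo⟧≡hi-xor-lo b ⟩
  ⟦ hi ⟧ b xor ⟦ lo ⟧ b ≡⟨ cong (_xor ⟦ lo ⟧ b) hi≡ ⟨
  ⟦ hi ⟧ a xor ⟦ lo ⟧ b ∎
  where open ≡-Reasoning

distinctCharacters-injective : ∀ {κ κ′ a b} → κ ≢ κ′ →
  ⟦ κ ⟧ a ≡ ⟦ κ ⟧ b → ⟦ κ′ ⟧ a ≡ ⟦ κ′ ⟧ b → a ≡ b
distinctCharacters-injective {hi}    {hi}    κ≢κ′ _ _ = contradiction refl κ≢κ′
distinctCharacters-injective {lo}    {lo}    κ≢κ′ _ _ = contradiction refl κ≢κ′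
distinctCharacters-injective {hi+lo} {hi+lo} κ≢κ′ _ _ = contradiction refl κ≢κ′
distinctCharacters-injective {hi}    {lo}    _ h≡ l≡ = bits-injective h≡ l≡
distinctCharacters-injective {lo}    {hi}    _ l≡ h≡ = bits-injective h≡ l≡
distinctCharacters-injective {hi}    {hi+lo} _ h≡ s≡ = bits-injective h≡ (lo-fromOthers h≡ s≡)
distinctCharacters-injective {hi+lo} {hi}    _ s≡ h≡ = bits-injective h≡ (lo-fromOthers h≡ s≡)
distinctCharacters-injective {lo}    {hi+lo} _ l≡ s≡ = bits-injective (hi-fromOthers l≡ s≡) l≡
distinctCharacters-injective {hi+lo} {lo}    _ s≡ l≡ = bits-injective (hi-fromOthers l≡ s≡) l≡

graph : Character → Character → (Bool → Bool) → Alphabet → Bool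
graph κ κ′ β a = ⟦ κ ⟧ a == β (⟦ κ′ ⟧ a)

graph-separates : ∀ {κ κ′} β {a b} → κ ≢ κ′ → graph κ κ′ β a ≡ true → graph κ κ′ β b ≡ true →
                  a ≢ b → ⟦ κ′ ⟧ a ≢ ⟦ κ′ ⟧ b
graph-separates {κ} {κ′} β {a} {b} κ≢κ′ a∈ b∈ a≢b κ′a≡κ′b = a≢b $
  distinctCharacters-injective κ≢κ′ κa≡κb κ′a≡κ′b
  where
  open ≡-Reasoning
  κa≡κb : ⟦ κ ⟧ a ≡ ⟦ κ ⟧ b
  κa≡κb = begin
    ⟦ κ ⟧ a      ≡⟨ ==⇒≡ a∈ ⟩
    β (⟦ κ′ ⟧ a) ≡⟨ cong β κ′a≡κ′b ⟩
    β (⟦ κ′ ⟧ b) ≡⟨ ==⇒≡ b∈ ⟨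
    ⟦ κ ⟧ b      ∎

graph-count : ∀ β → countᵇ (graph hi hi+lo β) (allFin 4) ≡ 2
graph-count β with β false | β true
... | false | false = refl
... | false | true  = refl
... | true  | false = refl
... | true  | true  = refl

level-count : ∀ κ b → countᵇ (λ a → ⟦ κ ⟧ a == b) (allFin 4) ≡ 2
level-count hi    false = refl
level-count hi    true  = refl
level-count lo    false = refl
level-count lo    true  = refl
level-count hi+lo false = refl
level-count hi+lo true  = refl

parity : Character → Word n → Bool
parity κ = foldr′ (λ a → ⟦ κ ⟧ a xor_) false

allOf : (Alphabet → Bool) → Word n → Bool
allOf f = foldr′ (λ a → f a ∧_) true

parity-insertAt : ∀ κ (z : Word n) j e → parity κ (insertAt z j e) ≡ ⟦ κ ⟧ e xor parity κ z
parity-insertAt κ = foldr′-insertAt _ (λ x y → xor-leftComm (⟦ κ ⟧ x) (⟦ κ ⟧ y)) false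

allOf-insertAt : ∀ f (z : Word n) j e → allOf f (insertAt z j e) ≡ f e ∧ allOf f z
allOf-insertAt f = foldr′-insertAt _ (λ x y → ∧-leftComm (f x) (f y)) true

parity-zero : ∀ {κ} {t : Word n} → All (λ a → ⟦ κ ⟧ a ≡ false) t → parity κ t ≡ false
parity-zero []           = refl
parity-zero (κa≡0 ∷ κt≡0) rewrite κa≡0 = parity-zero κt≡0

allOf-true : ∀ {f} {t : Word n} → All (λ a → f a ≡ true) t → allOf f t ≡ true
allOf-true []             = refl
allOf-true (fa≡1 ∷ ft≡1) rewrite fa≡1 = allOf-true ft≡1

data OnLine : Word n → Word n → Set where
  line : ∀ (z : Word n) j {a b} → a ≢ b → OnLine (insertAt z j a) (insertAt z j b)

adjacent⇒onLine : {x y : Word n} → Adjacent x y → OnLine x y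
adjacent⇒onLine {n = suc n} {x} {y} (i , xᵢ≢yᵢ , y≡x[i]≔yᵢ) =
  subst₂ OnLine (insertAt-removeAt x i) (sym y≡line) (line (removeAt x i) i xᵢ≢yᵢ)
  where
  y≡line : y ≡ insertAt (removeAt x i) i (lookup y i)
  y≡line = trans y≡x[i]≔yᵢ ([]≔-as-insertAt x i (lookup y i))

onLine⇒adjacent : {x y : Word n} → OnLine x y → Adjacent x y
onLine⇒adjacent (line z j {a} {b} a≢b) =
  j , subst₂ _≢_ (sym (insertAt-lookup z j a)) (sym (insertAt-lookup z j b)) a≢b ,
  sym (trans (cong (insertAt z j a [ j ]≔_) (insertAt-lookup z j b)) (insertAt-[]≔ z j a b))

insertAt-adjacent : ∀ {x y : Word n} k a →
                    Adjacent x y → Adjacent (insertAt x k a) (insertAt y k a)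
insertAt-adjacent {x = x} {y} k a (i , xᵢ≢yᵢ , y≡x[i]≔yᵢ) =
  punchIn k i , subst₂ _≢_ (sym (insertAt-punchIn x k a i)) (sym (insertAt-punchIn y k a i)) xᵢ≢yᵢ ,
  (begin
    insertAt y k a                              ≡⟨ cong (λ v → insertAt v k a) y≡x[i]≔yᵢ ⟩
    insertAt (x [ i ]≔ lookup y i) k a          ≡⟨ insertAt-[]≔-punchIn x k i a (lookup y i) ⟩
    insertAt x k a [ punchIn k i ]≔ lookup y i  ≡⟨ cong (insertAt x k a [ punchIn k i ]≔_)
                                                        (insertAt-punchIn y k a i) ⟨
    insertAt x k a [ punchIn k i ]≔ lookup (insertAt y k a) (punchIn k i) ∎)
  where open ≡-Reasoning

isDoubleMDS-byLines : {S : Code (suc n)} →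
  (∀ z j → countᵇ (λ e → S (insertAt z j e)) (allFin 4) ≡ 2) → IsDoubleMDS S
isDoubleMDS-byLines {S = S} lines i x =
  trans (countᵇ-cong (cong S ∘ []≔-as-insertAt x i) (allFin 4)) (lines (removeAt x i) i)

layer-isDoubleMDS : ∀ {S : Code (suc n)} → IsDoubleMDS S → ∀ i a → IsDoubleMDS (layer S i a)
layer-isDoubleMDS {S = S} S-mds i a j x =
  trans (countᵇ-cong (cong S ∘ insertAt-[]≔-punchIn x i j a) (allFin 4))
        (S-mds (punchIn i j) (insertAt x i a))

ProperColouring : Code n → (Word n → Bool) → Set
ProperColouring {n} S colour =
  ∀ {x y : Word n} → S x ≡ true → S y ≡ true → Adjacent x y → colour x ≢ colour y

properColouring-byLines : ∀ {S : Code n} {colour} →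
  (∀ {x y} → OnLine x y → S x ≡ true → S y ≡ true → colour x ≢ colour y) → ProperColouring S colour
properColouring-byLines onLines Sx Sy adj = onLines (adjacent⇒onLine adj) Sx Sy

properColouring⇒splittable : ∀ {S : Code n} {colour} → ProperColouring S colour → Splittable S
properColouring⇒splittable {S = S} {colour} proper =
  (λ x → S x ∧ colour x) , (λ x → S x ∧ not (colour x)) , cover , independentˡ , independentʳ
  where
  open ≡-Reasoning
  cover : ∀ x → S x ≡ (S x ∧ colour x) ∨ (S x ∧ not (colour x))
  cover x = begin
    S x                                    ≡⟨ ∧-identityʳ (S x) ⟨
    S x ∧ true                             ≡⟨ cong (S x ∧_) (∨-inverseʳ (colour x)) ⟨
    S x ∧ (colour x ∨ not (colour x))      ≡⟨ ∧-distribˡ-∨ (S x) (colour x) (not (colour x)) ⟩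
    (S x ∧ colour x) ∨ (S x ∧ not (colour x)) ∎
  independentˡ : Independent (λ x → S x ∧ colour x)
  independentˡ x y x∈ y∈ adj = proper (∧-conicalˡ _ _ x∈) (∧-conicalˡ _ _ y∈) adj
    (trans (∧-conicalʳ _ _ x∈) (sym (∧-conicalʳ _ _ y∈)))
  independentʳ : Independent (λ x → S x ∧ not (colour x))
  independentʳ x y x∈ y∈ adj = proper (∧-conicalˡ _ _ x∈) (∧-conicalˡ _ _ y∈) adj
    (not-injective (trans (∧-conicalʳ _ _ x∈) (sym (∧-conicalʳ _ _ y∈))))

splittable⇒properColouring : ∀ {S : Code n} → Splittable S → ∃ (ProperColouring S)
splittable⇒properColouring {S = S} (A , B , S≡A∨B , A-independent , B-independent) = A , proper
  where
  inB : ∀ {x} → S x ≡ true → A x ≡ false → B x ≡ true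
  inB {x} Sx Ax = trans (cong (_∨ B x) (sym Ax)) (trans (sym (S≡A∨B x)) Sx)
  proper : ProperColouring S A
  proper {x} {y} Sx Sy adj Ax≡Ay with A x in Ax
  ... | true  = A-independent x y Ax (sym Ax≡Ay) adj
  ... | false = B-independent x y (inB Sx Ax) (inB Sy (sym Ax≡Ay)) adj

data Walk (S : Code n) : Word n → Word n → Bool → Set where
  []   : ∀ {x} → Walk S x x false
  step : ∀ {x y z b} → Adjacent x y → S y ≡ true → Walk S y z b → Walk S x z (not b)

_++_ : ∀ {S : Code n} {x y z b b′} → Walk S x y b → Walk S y z b′ → Walk S x z (b xor b′)
[]                  ++ w′ = w′
step {b = b} adj Sy w ++ w′ = subst (Walk _ _ _) (not-distribˡ-xor b _) (step adj Sy (w ++ w′))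

walk-colour : ∀ {S : Code n} {colour x y b} → ProperColouring S colour → S x ≡ true →
              Walk S x y b → colour y ≡ b xor colour x
walk-colour proper Sx [] = refl
walk-colour {colour = colour} {x} proper Sx (step {y = y} {b = b} adj Sy w) = begin
  _                         ≡⟨ walk-colour proper Sy w ⟩
  b xor colour y            ≡⟨ cong (b xor_) (¬-not (proper Sx Sy adj ∘ sym)) ⟩
  b xor not (colour x)      ≡⟨ not-distribʳ-xor b (colour x) ⟨
  not (b xor colour x)      ≡⟨ not-distribˡ-xor b (colour x) ⟩
  not b xor colour x        ∎
  where open ≡-Reasoning

oddClosedWalk⇒¬splittable : ∀ {S : Code n} {x} → S x ≡ true → Walk S x x true → ¬ Splittable S
oddClosedWalk⇒¬splittable Sx w split with splittable⇒properColouring split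
... | colour , proper = not-¬ refl (walk-colour proper Sx w)

odd : ℕ → Bool
odd zero    = false
odd (suc r) = not (odd r)

cubeWalk : ∀ {r} {S : Code n} {P : Alphabet → Set} {a b} (f : Word r → Word n) →
  (∀ {t t′} → Adjacent t t′ → Adjacent (f t) (f t′)) → (∀ {t} → All P t → S (f t) ≡ true) →
  P a → P b → a ≢ b → Walk S (f (replicate r a)) (f (replicate r b)) (odd r)
cubeWalk {r = zero}  f f-adjacent inS Pa Pb a≢b = []
cubeWalk {r = suc r} {a = a} {b} f f-adjacent inS Pa Pb a≢b =
  step (f-adjacent (onLine⇒adjacent (line (replicate r a) zero a≢b)))
       (inS (Pb ∷ All-replicate Pa)) $
  cubeWalk (f ∘ (b ∷_)) (f-adjacent ∘ insertAt-adjacent zero b) (inS ∘ (Pb ∷_)) Pa Pb a≢b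

pickCharacter : Bool → Bool → Character
pickCharacter true  _     = hi
pickCharacter false true  = lo
pickCharacter false false = hi+lo

columnCharacter : Word n → Character
columnCharacter y = pickCharacter (allOf (not ∘′ ⟦ hi+lo ⟧) y) (allOf ⟦ hi+lo ⟧ y)

M : Code (suc n)
M (c ∷ y) = ⟦ columnCharacter y ⟧ c == parity hi y

excludedBy : Bool → Character
excludedBy false = lo
excludedBy true  = hi

columnCharacter-avoids : ∀ (t : Word n) k a →
                         columnCharacter (insertAt t k a) ≢ excludedBy (⟦ hi+lo ⟧ a)
columnCharacter-avoids t k a
  rewrite allOf-insertAt (not ∘′ ⟦ hi+lo ⟧) t k a | allOf-insertAt ⟦ hi+lo ⟧ t k a =
  avoids (⟦ hi+lo ⟧ a) (allOf (not ∘′ ⟦ hi+lo ⟧) t) (allOf ⟦ hi+lo ⟧ t)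
  where
  avoids : ∀ w p q → pickCharacter (not w ∧ p) (w ∧ q) ≢ excludedBy w
  avoids false true  _     ()
  avoids false false _     ()
  avoids true  _     true  ()
  avoids true  _     false ()

M-tailLine : ∀ c (z : Word n) j → ∃ λ β → ∀ e → M (c ∷ insertAt z j e) ≡ graph hi hi+lo β e
M-tailLine c z j = β , onGraph
  where
  κ : Bool → Character
  κ w = pickCharacter (not w ∧ allOf (not ∘′ ⟦ hi+lo ⟧) z) (w ∧ allOf ⟦ hi+lo ⟧ z)
  β : Bool → Bool
  β w = ⟦ κ w ⟧ c xor parity hi z
  onGraph : ∀ e → M (c ∷ insertAt z j e) ≡ graph hi hi+lo β e
  onGraph e
    rewrite allOf-insertAt (not ∘′ ⟦ hi+lo ⟧) z j e | allOf-insertAt ⟦ hi+lo ⟧ z j e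
          | parity-insertAt hi z j e =
    cong not (xor-leftComm (⟦ κ (⟦ hi+lo ⟧ e) ⟧ c) (⟦ hi ⟧ e) (parity hi z))

M-isDoubleMDS : IsDoubleMDS (M {n})
M-isDoubleMDS = isDoubleMDS-byLines {S = M} lines
  where
  lines : ∀ z j → countᵇ (λ e → M (insertAt z j e)) (allFin 4) ≡ 2
  lines z       zero    = level-count (columnCharacter z) (parity hi z)
  lines (c ∷ z) (suc j) with M-tailLine c z j
  ... | β , onGraph = trans (countᵇ-cong onGraph (allFin 4)) (graph-count β)

layerHead-colouring : ∀ c → ProperColouring (layer (M {suc n}) zero c) (parity hi+lo)
layerHead-colouring c = properColouring-byLines onLines
  where
  onLines : ∀ {x y} → OnLine x y → M (c ∷ x) ≡ true → M (c ∷ y) ≡ true →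
            parity hi+lo x ≢ parity hi+lo y
  onLines (line z j {a} {b} a≢b) Ma Mb parity≡ with M-tailLine c z j
  ... | β , onGraph =
    graph-separates {hi} β (λ ()) (trans (sym (onGraph a)) Ma) (trans (sym (onGraph b)) Mb) a≢b $
      ∙-cancelʳ (parity hi+lo z) (⟦ hi+lo ⟧ a) (⟦ hi+lo ⟧ b) $ begin
        ⟦ hi+lo ⟧ a xor parity hi+lo z ≡⟨ parity-insertAt hi+lo z j a ⟨
        parity hi+lo (insertAt z j a)  ≡⟨ parity≡ ⟩
        parity hi+lo (insertAt z j b)  ≡⟨ parity-insertAt hi+lo z j b ⟩
        ⟦ hi+lo ⟧ b xor parity hi+lo z ∎
    where open ≡-Reasoning

tailLetterColouring : Bool → Word (suc n) → Bool
tailLetterColouring w (c ∷ t) = ⟦ excludedBy w ⟧ c xor parity hi+lo t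

layerTail-colouring : ∀ k a →
  ProperColouring (layer (M {suc n}) (suc k) a) (tailLetterColouring (⟦ hi+lo ⟧ a))
layerTail-colouring k a = properColouring-byLines onLines
  where
  open ≡-Reasoning
  w = ⟦ hi+lo ⟧ a
  onLines : ∀ {x y} → OnLine x y → layer M (suc k) a x ≡ true → layer M (suc k) a y ≡ true →
            tailLetterColouring w x ≢ tailLetterColouring w y
  onLines (line t zero {c} {c′} c≢c′) Mc Mc′ =
    xor-≢ʳ (parity hi+lo t) $
      graph-separates (const (parity hi (insertAt t k a))) (columnCharacter-avoids t k a) Mc Mc′ c≢c′
  onLines (line (c ∷ z) (suc j) {e} {e′} e≢e′) Me Me′ =
    xor-≢ˡ (⟦ excludedBy w ⟧ c) λ parity≡ →
      layerHead-colouring c Me Me′ (insertAt-adjacent k a (onLine⇒adjacent (line z j e≢e′))) $ begin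
        parity hi+lo (insertAt (insertAt z j e) k a)  ≡⟨ parity-insertAt hi+lo (insertAt z j e) k a ⟩
        w xor parity hi+lo (insertAt z j e)           ≡⟨ cong (w xor_) parity≡ ⟩
        w xor parity hi+lo (insertAt z j e′)          ≡⟨ parity-insertAt hi+lo (insertAt z j e′) k a ⟨
        parity hi+lo (insertAt (insertAt z j e′) k a) ∎

layer-isSplittable : ∀ i a → Splittable (layer (M {suc n}) i a)
layer-isSplittable zero    a = properColouring⇒splittable (layerHead-colouring a)
layer-isSplittable (suc k) a = properColouring⇒splittable (layerTail-colouring k a)

Low : Alphabet → Set
Low a = ⟦ hi ⟧ a ≡ false

M-0∷low : ∀ (y : Word n) → All Low y → M (0F ∷ y) ≡ true
M-0∷low y low rewrite ⟦⟧-0F (columnCharacter y) | parity-zero low = refl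

M-1∷0ⁿ : ∀ n → M (1F ∷ replicate n 0F) ≡ true
M-1∷0ⁿ n rewrite allOf-true {f = not ∘′ ⟦ hi+lo ⟧} (All-replicate {n = n} {a = 0F} refl)
               | parity-zero {κ = hi} (All-replicate {n = n} {a = 0F} refl) = refl

M-1∷2∷low : ∀ {t : Word n} → All Low t → M (1F ∷ 2F ∷ t) ≡ true
M-1∷2∷low {t = t} low rewrite parity-zero low with allOf ⟦ hi+lo ⟧ t
... | true  = refl
... | false = refl

M-3∷2∷1ⁿ : ∀ n → M (3F ∷ 2F ∷ replicate n 1F) ≡ true
M-3∷2∷1ⁿ n rewrite allOf-true {f = ⟦ hi+lo ⟧} (All-replicate {n = n} {a = 1F} refl)
                 | parity-zero {κ = hi} (All-replicate {n = n} {a = 1F} refl) = refl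

M-3∷0∷1ⁿ⁺¹ : ∀ n → M (3F ∷ 0F ∷ replicate (suc n) 1F) ≡ true
M-3∷0∷1ⁿ⁺¹ n rewrite parity-zero {κ = hi} (All-replicate {n = n} {a = 1F} refl) = refl

-- The two cube segments have the same length, so the five remaining steps make the cycle odd.
cycle-parity : ∀ p → not (not (p xor not (not (not p)))) ≡ true
cycle-parity false = refl
cycle-parity true  = refl

M-notSplittable : ∀ r → ¬ Splittable (M {suc (suc r)})
M-notSplittable r =
  oddClosedWalk⇒¬splittable (M-0∷low (0F ∷ zeros) (refl ∷ lowZeros))
    (subst (Walk M _ _) (cycle-parity (odd (suc r))) oddCycle)
  where
  zeros ones : Word (suc r)
  zeros = replicate (suc r) 0F
  ones  = replicate (suc r) 1F
  lowZeros : All Low zeros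
  lowZeros = All-replicate refl
  headChange : ∀ {m} {y : Word m} {a b} → a ≢ b → Adjacent (a ∷ y) (b ∷ y)
  headChange a≢b = onLine⇒adjacent (line _ zero a≢b)
  secondChange : ∀ {m c} {y : Word m} {a b} → a ≢ b → Adjacent (c ∷ a ∷ y) (c ∷ b ∷ y)
  secondChange a≢b = onLine⇒adjacent (line (_ ∷ _) (suc zero) a≢b)
  deep : ∀ c d {t t′ : Word (suc r)} → Adjacent t t′ → Adjacent (c ∷ d ∷ t) (c ∷ d ∷ t′)
  deep c d = insertAt-adjacent zero c ∘ insertAt-adjacent zero d
  oddCycle : Walk M (0F ∷ 0F ∷ zeros) (0F ∷ 0F ∷ zeros) _
  oddCycle =
    step (headChange (λ ())) (M-1∷0ⁿ (suc (suc r))) $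
    step (secondChange (λ ())) (M-1∷2∷low lowZeros) $
    cubeWalk {a = 0F} {1F} (λ t → 1F ∷ 2F ∷ t) (deep 1F 2F) M-1∷2∷low refl refl (λ ()) ++
    (step (headChange (λ ())) (M-3∷2∷1ⁿ (suc r)) $
     step (secondChange (λ ())) (M-3∷0∷1ⁿ⁺¹ r) $
     step (headChange (λ ())) (M-0∷low (0F ∷ ones) (refl ∷ All-replicate refl)) $
     cubeWalk {a = 1F} {0F} (λ t → 0F ∷ 0F ∷ t) (deep 0F 0F)
              (λ low → M-0∷low (0F ∷ _) (refl ∷ low)) refl refl (λ ()))

theorem4 : (m : ℕ) → 2 ≤ m →
    Σ (Code (suc m)) λ M →
      IsDoubleMDS M × ¬ Splittable M ×
      ((i : Fin (suc m)) (a : Alphabet) →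
        IsDoubleMDS (layer M i a) × Splittable (layer M i a))
theorem4 (suc (suc r)) (s≤s (s≤s z≤n)) =
  M , M-isDoubleMDS , M-notSplittable r ,
  λ i a → layer-isDoubleMDS {S = M} M-isDoubleMDS i a , layer-isSplittable i a
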